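{- Suppose there is a walk in $G$ that passes vertices $v_0,v_1,\ldots,v_k\in V$ and edges $e_1,\ldots,e_k\in E$ in this order (so $e_i=\{v_{i-1},v_i\}$). Then $$\sum_{i=1}^k \mu_{e_i}(v_i)\,\mathbf{e}_i^\circ=\mathbf{v}_k^\circ-\mathbf{v}_0^\circ,\qquad \sum_{i=1}^k \mu_{e_i}(v_i)\,\mathbf{e}_i^\bullet=\mathbf{v}_k^\bullet-\mathbf{v}_0^\bullet.$$ Moreover, if $v_0,v_k\in T$, then $$\theta(v_k)\sum_{i=1}^k \mu_{e_i}(v_i)\,\mathbf{e}_i^\circ-\sum_{i=1}^k \mu_{e_i}(v_i)\,\mathbf{e}_i^\bullet=(\theta(v_0)-\theta(v_k))\,\mathbf{v}_0.$$
   Context: Let $G=(V,E)$ be a finite simple undirected graph, $T\subseteq V$ a set of terminals with $|T|=k$, $|V|=n$, and $\mathcal{S}$ a partition of $T$ into non-empty blocks with $|\mathcal{S}|\ge 2$. Let $q$ be the least prime with $|\mathcal{S}|<q\le 2|\mathcal{S}|$, and let $\theta:T\to\mathbb{F}_q$ be such that $\theta(t)=\theta(t')$ iff $t,t'$ lie in the same block of $\mathcal{S}$. For each edge $e\in E$ fix a bijection $\mu_e:e\to\{1,-1\}\subseteq\mathbb{F}_q$ (so the two endpoints of $e$ receive opposite signs). Let $W$ be the $(2n-k)$-dimensional vector space over $\mathbb{F}_q$ with basis consisting of a vector $\mathbf{t}$ for each $t\in T$ and two vectors $\mathbf{v}^\circ,\mathbf{v}^\bullet$ for each $v\in V\setminus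 T$. For $t\in T$ set $\mathbf{t}^\circ:=\mathbf{t}$ and $\mathbf{t}^\bullet:=\theta(t)\mathbf{t}$. For each edge $e=\{u,v\}\in E$ set $\mathbf{e}^\circ:=\mu_e(u)\mathbf{u}^\circ+\mu_e(v)\mathbf{v}^\circ$ and $\mathbf{e}^\bullet:=\mu_e(u)\mathbf{u}^\bullet+\mu_e(v)\mathbf{v}^\bullet$. -}

module Defs where

open import Data.Nat using (ℕ; zero; suc; _+_; _*_; _∸_; NonZero; _<_; _≤_)
open import Data.Nat.DivMod using (_mod_)
open import Data.Nat.Primality using (Prime)
open import Data.Fin using (Fin; toℕ; inject₁; fromℕ; _≟_) renaming (zero to fz; suc to fs)
open import Data.Fin.Subset using (Subset; _∈_; _∉_)
open import Data.Fin.Subset.Properties using (_∈?_)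
open import Data.Product using (Σ; _×_; _,_)
open import Data.Empty using (⊥)
open import Relation.Nullary using (yes; no; ¬_)
open import Relation.Binary.PropositionalEquality using (_≡_)

F : ℕ → Set
F q = Fin q

module _ {q : ℕ} .{{_ : NonZero q}} where

  0F 1F : F q
  0F = 0 mod q
  1F = 1 mod q

  infixl 6 _+F_ _-F_
  infixl 7 _*F_
  infix 8 -F_

  _+F_ _*F_ : F q → F q → F q
  a +F b = (toℕ a + toℕ b) mod q
  a *F b = (toℕ a * toℕ b) mod q

  -F_ : F q → F q
  -F a = (q ∸ toℕ a) mod q

  _-F_ : F q → F q → F q
  a -F b = a +F (-F b)

IsLeastPrimeIn : ℕ → ℕ → Set
IsLeastPrimeIn s q = Prime q × s < q × q ≤ 2 * s × (∀ p → Prime p → s < p → p < q → ⊥)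

-- Basis: one vector t for each t ∈ T, two vectors v° , v• for v ∉ T.
-- A basis element is indexed by (v , c , _) where c is the colour and
-- the last component says that the colour black only occurs for v ∉ T.
-- (t ∈ T is indexed by (t , white , _).)

data Col : Set where
  white black : Col

Coord : (n : ℕ) → Subset n → Set
Coord n T = Σ (Fin n) λ v → Σ Col λ c → (c ≡ black → v ∉ T)

W : ℕ → (n : ℕ) → Subset n → Set
W q n T = Coord n T → F q

module _ {q : ℕ} .{{_ : NonZero q}} {n : ℕ} {T : Subset n} where

  infixl 6 _+W_ _-W_
  infixr 7 _·W_
  infix 4 _≈W_

  0W : W q n T
  0W _ = 0F

  _+W_ _-W_ : W q n T → W q n T → W q n T
  (x +W y) i = x i +F y i
  (x -W y) i = x i -F y i

  _·W_ : F q → W q n T → W q n T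
  (a ·W x) i = a *F x i

  _≈W_ : W q n T → W q n T → Set
  x ≈W y = ∀ i → x i ≡ y i

  ΣW : (m : ℕ) → (Fin m → W q n T) → W q n T
  ΣW zero f = 0W
  ΣW (suc m) f = f fz +W ΣW m (λ i → f (fs i))

unitAt : {q n : ℕ} .{{_ : NonZero q}} {T : Subset n} → Fin n → Col → W q n T
unitAt v c (w , c' , _) with w ≟ v | c | c'
... | yes _ | white | white = 1F
... | yes _ | black | black = 1F
... | _     | _     | _     = 0F

-- v° (for v ∈ T this is the basis vector t = t°)
vo : {q n : ℕ} .{{_ : NonZero q}} (T : Subset n) → Fin n → W q n T
vo T v = unitAt v white

vb : {q n : ℕ} .{{_ : NonZero q}} (T : Subset n) →
     (θ : (t : Fin n) → t ∈ T → F q) → Fin n → W q n T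
vb T θ v with v ∈? T
... | yes p = θ v p ·W vo T v
... | no _  = unitAt v black

-- Convention: μ u v denotes μ_e(u) for the edge e = {u , v}.
-- e° and e• for e = {u , v}
eo : {q n : ℕ} .{{_ : NonZero q}} (T : Subset n) →
     (μ : Fin n → Fin n → F q) → Fin n → Fin n → W q n T
eo T μ u v = μ u v ·W vo T u +W μ v u ·W vo T v

eb : {q n : ℕ} .{{_ : NonZero q}} (T : Subset n) →
     (θ : (t : Fin n) → t ∈ T → F q) →
     (μ : Fin n → Fin n → F q) → Fin n → Fin n → W q n T
eb T θ μ u v = μ u v ·W vb T θ u +W μ v u ·W vb T θ v

-- For a walk w 0 , … , w m with e_{i} = {w (i-1) , w i} (i = 1 … m):
--   walkSumO = Σ_{i=1}^m μ_{e_i}(w i) e_i°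
--   walkSumB = Σ_{i=1}^m μ_{e_i}(w i) e_i•
walkSumO : {q n : ℕ} .{{_ : NonZero q}} (T : Subset n) →
           (μ : Fin n → Fin n → F q) → (m : ℕ) → (Fin (suc m) → Fin n) → W q n T
walkSumO T μ m w =
  ΣW m (λ i → μ (w (fs i)) (w (inject₁ i)) ·W eo T μ (w (inject₁ i)) (w (fs i)))

walkSumB : {q n : ℕ} .{{_ : NonZero q}} (T : Subset n) →
           (θ : (t : Fin n) → t ∈ T → F q) →
           (μ : Fin n → Fin n → F q) → (m : ℕ) → (Fin (suc m) → Fin n) → W q n T
walkSumB T θ μ m w =
  ΣW m (λ i → μ (w (fs i)) (w (inject₁ i)) ·W eb T θ μ (w (inject₁ i)) (w (fs i)))

{-# OPTIONS --safe #-}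
module Submission where

-- On an edge e = {u , v} the signs μ_e(u), μ_e(v) are opposite units, so
-- μ_e(v) e = μ_e(v) μ_e(u) u + μ_e(v)² v = v − u in either colour, and each walk sum
-- telescopes to the difference of its end vectors. At terminals v• = θ(v) v°, so the last
-- identity is the ring identity θₖ (xₖ − x₀) − (θₖ xₖ − θ₀ x₀) = (θ₀ − θₖ) x₀, read
-- coordinatewise. Fin q with arithmetic mod q is a commutative ring because reduction
-- mod q is a surjective semiring map from ℕ.

open import Defs
open import Algebra.Bundles using (AbelianGroup; CommutativeRing)
open import Algebra.Consequences.Propositional using (comm∧idˡ⇒id; comm∧invʳ⇒inv; comm∧distrˡ⇒distr)
import Algebra.Properties.AbelianGroup as AbelianGroupProperties
import Algebra.Properties.Group as GroupProperties
import Algebra.Properties.Monoid.Sum as MonoidSum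
import Algebra.Properties.Ring as RingProperties
open import Algebra.Structures using (IsCommutativeRing)
open import Data.Empty using (⊥-elim)
open import Data.Fin using (Fin; toℕ; inject₁; fromℕ) renaming (zero to fz; suc to fs)
open import Data.Fin.Properties using (toℕ-fromℕ<; toℕ-injective; toℕ<n)
open import Data.Fin.Subset using (Subset; _∈_)
open import Data.Fin.Subset.Properties using (_∈?_)
open import Data.Nat using (ℕ; zero; suc; _∸_; _%_; _≤_; NonZero; >-nonZero⁻¹)
open import Data.Nat.DivMod using (_mod_; m%n<n; %-distribˡ-+; %-distribˡ-*; m<n⇒m%n≡m; n%n≡0)
import Data.Nat.Properties as ℕ
open import Data.Product using (Σ; ∃; _×_; _,_)
open import Data.Sum using (_⊎_; inj₁; inj₂)
open import Data.Vec.Properties.WithK using ([]=-irrelevant)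
open import Function using (_∘_)
open import Level using (0ℓ)
open import Relation.Nullary using (¬_; yes; no)
open import Relation.Binary.PropositionalEquality
  using (_≡_; cong; cong₂; subst; isEquivalence; module ≡-Reasoning)
import Relation.Binary.Reasoning.Setoid as SetoidReasoning

module _ {c ℓ} (G : AbelianGroup c ℓ) where
  open AbelianGroup G
  open MonoidSum monoid using (sum)
  open GroupProperties group using (//-rightDividesˡ)
  open SetoidReasoning setoid

  [x-y]∙[y-z]≈x-z : ∀ x y z → (x - y) ∙ (y - z) ≈ x - z
  [x-y]∙[y-z]≈x-z x y z = begin
    (x - y) ∙ (y - z)     ≈⟨ assoc (x - y) y (z ⁻¹) ⟨
    ((x - y) ∙ y) ∙ z ⁻¹  ≈⟨ ∙-congʳ (//-rightDividesˡ y x) ⟩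
    x - z                 ∎

  sum-telescopes : ∀ m (X : Fin (suc m) → Carrier) →
                   sum (λ i → X (fs i) - X (inject₁ i)) ≈ X (fromℕ m) - X fz
  sum-telescopes zero    X = sym (inverseʳ (X fz))
  sum-telescopes (suc m) X = begin
    (X (fs fz) - X fz) ∙ sum (λ i → X (fs (fs i)) - X (fs (inject₁ i)))
      ≈⟨ ∙-congˡ (sum-telescopes m (X ∘ fs)) ⟩
    (X (fs fz) - X fz) ∙ (X (fromℕ (suc m)) - X (fs fz))
      ≈⟨ comm _ _ ⟩
    (X (fromℕ (suc m)) - X (fs fz)) ∙ (X (fs fz) - X fz)
      ≈⟨ [x-y]∙[y-z]≈x-z _ _ _ ⟩
    X (fromℕ (suc m)) - X fz
      ∎

module _ {c ℓ} (R : CommutativeRing c ℓ) where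
  open CommutativeRing R
  open MonoidSum +-monoid using (sum; sum-cong-≋)
  open RingProperties ring using (-1*x≈-x; -‿involutive; -‿distribˡ-*; -‿distribʳ-*; x[y-z]≈xy-xz; [y-z]x≈yx-zx)
  open AbelianGroupProperties +-abelianGroup using (⁻¹-anti-homo‿-)
  open SetoidReasoning setoid

  IsSign : Carrier → Set ℓ
  IsSign a = a ≈ 1# ⊎ a ≈ - 1#

  sign*sign≈1 : ∀ {a} → IsSign a → a * a ≈ 1#
  sign*sign≈1 (inj₁ a≈1)  = trans (*-cong a≈1 a≈1) (*-identityˡ 1#)
  sign*sign≈1 (inj₂ a≈-1) = trans (*-cong a≈-1 a≈-1) (trans (-1*x≈-x (- 1#)) (-‿involutive 1#))

  opposite-signs⇒difference : ∀ {a b} x y → IsSign a → b ≈ - a → b * (a * x + b * y) ≈ y - x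
  opposite-signs⇒difference {a} {b} x y a-sign b≈-a = begin
    b * (a * x + b * y)        ≈⟨ distribˡ b (a * x) (b * y) ⟩
    b * (a * x) + b * (b * y)  ≈⟨ +-cong (*-assoc b a x) (*-assoc b b y) ⟨
    b * a * x + b * b * y      ≈⟨ +-cong (*-congʳ b*a≈-1) (*-congʳ b*b≈1) ⟩
    - 1# * x + 1# * y          ≈⟨ +-cong (-1*x≈-x x) (*-identityˡ y) ⟩
    - x + y                    ≈⟨ +-comm (- x) y ⟩
    y - x                      ∎
    where
    b*a≈-1 : b * a ≈ - 1#
    b*a≈-1 = begin
      b * a      ≈⟨ *-congʳ b≈-a ⟩
      - a * a    ≈⟨ -‿distribˡ-* a a ⟨
      - (a * a)  ≈⟨ -‿cong (sign*sign≈1 a-sign) ⟩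
      - 1#       ∎
    b*b≈1 : b * b ≈ 1#
    b*b≈1 = begin
      b * b      ≈⟨ *-congˡ b≈-a ⟩
      b * - a    ≈⟨ -‿distribʳ-* b a ⟨
      - (b * a)  ≈⟨ -‿cong b*a≈-1 ⟩
      - - 1#     ≈⟨ -‿involutive 1# ⟩
      1#         ∎

  signed-sum-telescopes : ∀ m (a b : Fin m → Carrier) (X : Fin (suc m) → Carrier) →
    (∀ i → IsSign (a i) × b i ≈ - a i) →
    sum (λ i → b i * (a i * X (inject₁ i) + b i * X (fs i))) ≈ X (fromℕ m) - X fz
  signed-sum-telescopes m a b X signs = trans
    (sum-cong-≋ λ i → let (a-sign , b≈-a) = signs i in opposite-signs⇒difference _ _ a-sign b≈-a)
    (sum-telescopes +-abelianGroup m X)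

  x[y-z]-[xy-wz]≈[w-x]z : ∀ x y z w → x * (y - z) - (x * y - w * z) ≈ (w - x) * z
  x[y-z]-[xy-wz]≈[w-x]z x y z w = begin
    x * (y - z) - (x * y - w * z)          ≈⟨ +-cong (x[y-z]≈xy-xz x y z) (⁻¹-anti-homo‿- (x * y) (w * z)) ⟩
    (x * y - x * z) + (w * z - x * y)      ≈⟨ +-comm _ _ ⟩
    (w * z - x * y) + (x * y - x * z)      ≈⟨ [x-y]∙[y-z]≈x-z +-abelianGroup _ _ _ ⟩
    w * z - x * z                          ≈⟨ [y-z]x≈yx-zx z w x ⟨
    (w - x) * z                            ∎

module _ {q : ℕ} .{{_ : NonZero q}} where
  open import Data.Nat using (_+_; _*_)
  open import Relation.Binary.PropositionalEquality using (sym; trans)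
  open ≡-Reasoning

  toℕ-mod : ∀ x → toℕ (x mod q) ≡ x % q
  toℕ-mod x = toℕ-fromℕ< (m%n<n x q)

  mod-cong : ∀ {x y} → x % q ≡ y % q → x mod q ≡ y mod q
  mod-cong {x} {y} eq = toℕ-injective (trans (toℕ-mod x) (trans eq (sym (toℕ-mod y))))

  mod-toℕ : (a : F q) → toℕ a mod q ≡ a
  mod-toℕ a = toℕ-injective (trans (toℕ-mod (toℕ a)) (m<n⇒m%n≡m (toℕ<n a)))

  mod-+-homo : ∀ x y → x mod q +F y mod q ≡ (x + y) mod q
  mod-+-homo x y = mod-cong (begin
    (toℕ (x mod q) + toℕ (y mod q)) % q ≡⟨ cong₂ (λ a b → (a + b) % q) (toℕ-mod x) (toℕ-mod y) ⟩
    (x % q + y % q) % q                 ≡⟨ %-distribˡ-+ x y q ⟨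
    (x + y) % q                         ∎)

  mod-*-homo : ∀ x y → (x mod q) *F (y mod q) ≡ (x * y) mod q
  mod-*-homo x y = mod-cong (begin
    (toℕ (x mod q) * toℕ (y mod q)) % q ≡⟨ cong₂ (λ a b → (a * b) % q) (toℕ-mod x) (toℕ-mod y) ⟩
    (x % q * (y % q)) % q               ≡⟨ %-distribˡ-* x y q ⟨
    (x * y) % q                         ∎)

  -- Every a : F q is the reduction of toℕ a, so laws of F q can be checked on reductions.
  ∀-mod₁ : {P : F q → Set} → (∀ x → P (x mod q)) → ∀ a → P a
  ∀-mod₁ {P} h a = subst P (mod-toℕ a) (h (toℕ a))

  ∀-mod₂ : {P : F q → F q → Set} → (∀ x y → P (x mod q) (y mod q)) → ∀ a b → P a b
  ∀-mod₂ h a = ∀-mod₁ λ y → ∀-mod₁ (λ x → h x y) a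

  ∀-mod₃ : {P : F q → F q → F q → Set} →
           (∀ x y z → P (x mod q) (y mod q) (z mod q)) → ∀ a b c → P a b c
  ∀-mod₃ h a = ∀-mod₂ λ y z → ∀-mod₁ (λ x → h x y z) a

  module _ (_∙_ : ℕ → ℕ → ℕ) (_⊙_ : F q → F q → F q)
           (homo : ∀ x y → (x mod q) ⊙ (y mod q) ≡ (x ∙ y) mod q) where

    assoc-mod : (∀ x y z → (x ∙ y) ∙ z ≡ x ∙ (y ∙ z)) → ∀ a b c → (a ⊙ b) ⊙ c ≡ a ⊙ (b ⊙ c)
    assoc-mod assoc = ∀-mod₃ λ x y z → begin
      ((x mod q) ⊙ (y mod q)) ⊙ (z mod q) ≡⟨ cong (_⊙ (z mod q)) (homo x y) ⟩
      ((x ∙ y) mod q) ⊙ (z mod q)         ≡⟨ homo (x ∙ y) z ⟩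
      ((x ∙ y) ∙ z) mod q                 ≡⟨ cong (_mod q) (assoc x y z) ⟩
      (x ∙ (y ∙ z)) mod q                 ≡⟨ homo x (y ∙ z) ⟨
      (x mod q) ⊙ ((y ∙ z) mod q)         ≡⟨ cong ((x mod q) ⊙_) (homo y z) ⟨
      (x mod q) ⊙ ((y mod q) ⊙ (z mod q)) ∎

    comm-mod : (∀ x y → x ∙ y ≡ y ∙ x) → ∀ a b → a ⊙ b ≡ b ⊙ a
    comm-mod comm = ∀-mod₂ λ x y → begin
      (x mod q) ⊙ (y mod q) ≡⟨ homo x y ⟩
      (x ∙ y) mod q         ≡⟨ cong (_mod q) (comm x y) ⟩
      (y ∙ x) mod q         ≡⟨ homo y x ⟨
      (y mod q) ⊙ (x mod q) ∎

  +F-comm : ∀ a b → a +F b ≡ b +F a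
  +F-comm = comm-mod _+_ _+F_ mod-+-homo ℕ.+-comm

  *F-comm : ∀ a b → a *F b ≡ b *F a
  *F-comm = comm-mod _*_ _*F_ mod-*-homo ℕ.*-comm

  +F-identityˡ : ∀ a → 0F +F a ≡ a
  +F-identityˡ = ∀-mod₁ (mod-+-homo 0)

  *F-identityˡ : ∀ a → 1F *F a ≡ a
  *F-identityˡ = ∀-mod₁ λ x → trans (mod-*-homo 1 x) (cong (_mod q) (ℕ.*-identityˡ x))

  +F-inverseʳ : ∀ a → a +F -F a ≡ 0F
  +F-inverseʳ a = begin
    a +F -F a                              ≡⟨ cong (_+F -F a) (mod-toℕ a) ⟨
    toℕ a mod q +F (q ∸ toℕ a) mod q       ≡⟨ mod-+-homo (toℕ a) (q ∸ toℕ a) ⟩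
    (toℕ a + (q ∸ toℕ a)) mod q            ≡⟨ cong (_mod q) (ℕ.m+[n∸m]≡n (ℕ.<⇒≤ (toℕ<n a))) ⟩
    q mod q                                ≡⟨ mod-cong (trans (n%n≡0 q) (sym (m<n⇒m%n≡m (>-nonZero⁻¹ q)))) ⟩
    0F                                     ∎

  *F-distribˡ-+F : ∀ a b c → a *F (b +F c) ≡ a *F b +F a *F c
  *F-distribˡ-+F = ∀-mod₃ λ x y z → begin
    (x mod q) *F (y mod q +F z mod q)      ≡⟨ cong (x mod q *F_) (mod-+-homo y z) ⟩
    (x mod q) *F ((y + z) mod q)           ≡⟨ mod-*-homo x (y + z) ⟩
    (x * (y + z)) mod q                    ≡⟨ cong (_mod q) (ℕ.*-distribˡ-+ x y z) ⟩
    (x * y + x * z) mod q                  ≡⟨ mod-+-homo (x * y) (x * z) ⟨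
    (x * y) mod q +F (x * z) mod q         ≡⟨ cong₂ _+F_ (mod-*-homo x y) (mod-*-homo x z) ⟨
    (x mod q) *F (y mod q) +F (x mod q) *F (z mod q) ∎

  +F-*F-isCommutativeRing : IsCommutativeRing _≡_ _+F_ _*F_ -F_ 0F 1F
  +F-*F-isCommutativeRing = record
    { isRing = record
      { +-isAbelianGroup = record
        { isGroup = record
          { isMonoid = record
            { isSemigroup = record
              { isMagma = record { isEquivalence = isEquivalence ; ∙-cong = cong₂ _+F_ }
              ; assoc = assoc-mod _+_ _+F_ mod-+-homo ℕ.+-assoc }
            ; identity = comm∧idˡ⇒id +F-comm +F-identityˡ }
          ; inverse = comm∧invʳ⇒inv +F-comm +F-inverseʳ
          ; ⁻¹-cong = cong (-F_) }
        ; comm = +F-comm }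
      ; *-cong = cong₂ _*F_
      ; *-assoc = assoc-mod _*_ _*F_ mod-*-homo ℕ.*-assoc
      ; *-identity = comm∧idˡ⇒id *F-comm *F-identityˡ
      ; distrib = comm∧distrˡ⇒distr (cong₂ _+F_) *F-comm *F-distribˡ-+F }
    ; *-comm = *F-comm }

+F-*F-commutativeRing : (q : ℕ) .{{_ : NonZero q}} → CommutativeRing 0ℓ 0ℓ
+F-*F-commutativeRing q = record { isCommutativeRing = +F-*F-isCommutativeRing {q} }

module _ {q : ℕ} .{{_ : NonZero q}} {n : ℕ} {T : Subset n} where
  private
    𝔽 : CommutativeRing 0ℓ 0ℓ
    𝔽 = +F-*F-commutativeRing q
  open MonoidSum (CommutativeRing.+-monoid 𝔽) using (sum)
  open import Relation.Binary.PropositionalEquality using (refl; trans)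
  open ≡-Reasoning

  ΣW-coordinate : ∀ m (f : Fin m → W q n T) j → ΣW m f j ≡ sum (λ i → f i j)
  ΣW-coordinate zero    f j = refl
  ΣW-coordinate (suc m) f j = cong (f fz j +F_) (ΣW-coordinate m (f ∘ fs) j)

  edgeVector : (Fin n → W q n T) → (Fin n → Fin n → F q) → Fin n → Fin n → W q n T
  edgeVector x μ u v = μ u v ·W x u +W μ v u ·W x v

  -- walkSumO T μ and walkSumB T θ μ are, definitionally, walkSum (vo T) μ and walkSum (vb T θ) μ.
  walkSum : (Fin n → W q n T) → (Fin n → Fin n → F q) → (m : ℕ) → (Fin (suc m) → Fin n) → W q n T
  walkSum x μ m w = ΣW m (λ i → μ (w (fs i)) (w (inject₁ i)) ·W edgeVector x μ (w (inject₁ i)) (w (fs i)))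

  walkSum-telescopes : ∀ (x : Fin n → W q n T) μ m (w : Fin (suc m) → Fin n) →
    (∀ i → IsSign 𝔽 (μ (w (inject₁ i)) (w (fs i)))
           × μ (w (fs i)) (w (inject₁ i)) ≡ -F μ (w (inject₁ i)) (w (fs i))) →
    walkSum x μ m w ≈W x (w (fromℕ m)) -W x (w fz)
  walkSum-telescopes x μ m w signs j = trans (ΣW-coordinate m _ j)
    (signed-sum-telescopes 𝔽 m
      (λ i → μ (w (inject₁ i)) (w (fs i))) (λ i → μ (w (fs i)) (w (inject₁ i))) (λ k → x (w k) j)
      signs)

  vb-∈ : (θ : (t : Fin n) → t ∈ T → F q) → ∀ {v} (v∈T : v ∈ T) → vb T θ v ≈W θ v v∈T ·W vo T v
  vb-∈ θ {v} v∈T j with v ∈? T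
  ... | yes v∈T′ = cong (λ p → θ v p *F vo T v j) ([]=-irrelevant v∈T′ v∈T)
  ... | no  v∉T  = ⊥-elim (v∉T v∈T)

  eliminate-endpoint : ∀ {S S′ x₀ xₘ y₀ yₘ : W q n T} (t₀ tₘ : F q) →
    S ≈W xₘ -W x₀ → S′ ≈W yₘ -W y₀ → yₘ ≈W tₘ ·W xₘ → y₀ ≈W t₀ ·W x₀ →
    tₘ ·W S -W S′ ≈W (t₀ -F tₘ) ·W x₀
  eliminate-endpoint {S} {S′} {x₀} {xₘ} {y₀} {yₘ} t₀ tₘ S≈ S′≈ yₘ≈ y₀≈ j = begin
    tₘ *F S j -F S′ j                                   ≡⟨ cong₂ (λ s s′ → tₘ *F s -F s′) (S≈ j) (S′≈ j) ⟩
    tₘ *F (xₘ j -F x₀ j) -F (yₘ j -F y₀ j)              ≡⟨ cong₂ (λ y y′ → tₘ *F (xₘ j -F x₀ j) -F (y -F y′)) (yₘ≈ j) (y₀≈ j) ⟩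
    tₘ *F (xₘ j -F x₀ j) -F (tₘ *F xₘ j -F t₀ *F x₀ j)  ≡⟨ x[y-z]-[xy-wz]≈[w-x]z 𝔽 tₘ (xₘ j) (x₀ j) t₀ ⟩
    (t₀ -F tₘ) *F x₀ j                                  ∎

lemma1 : (n : ℕ) (T : Subset n)
    (Adj : Fin n → Fin n → Set)
    (Adj-sym : ∀ u v → Adj u v → Adj v u)
    (Adj-irr : ∀ v → ¬ Adj v v)
    (s : ℕ) (2≤s : 2 ≤ s)
    (blk : (t : Fin n) → t ∈ T → Fin s)
    (blk-onto : ∀ b → ∃ λ t → Σ (t ∈ T) λ p → blk t p ≡ b)
    (q : ℕ) .{{_ : NonZero q}} (q-least : IsLeastPrimeIn s q)
    (θ : (t : Fin n) → t ∈ T → F q)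
    (θ-blk : ∀ t p t' p' → (θ t p ≡ θ t' p' → blk t p ≡ blk t' p') × (blk t p ≡ blk t' p' → θ t p ≡ θ t' p'))
    (μ : Fin n → Fin n → F q)
    (μ-ok : ∀ u v → Adj u v → (μ u v ≡ 1F ⊎ μ u v ≡ -F 1F) × μ v u ≡ -F μ u v)
    (m : ℕ) (w : Fin (suc m) → Fin n)
    (walk : ∀ i → Adj (w (inject₁ i)) (w (fs i))) →
    (walkSumO T μ m w ≈W (vo T (w (fromℕ m)) -W vo T (w fz)))
    × (walkSumB T θ μ m w ≈W (vb T θ (w (fromℕ m)) -W vb T θ (w fz)))
    × ((p0 : w fz ∈ T) (pm : w (fromℕ m) ∈ T) →
       (θ (w (fromℕ m)) pm ·W walkSumO T μ m w -W walkSumB T θ μ m w)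
         ≈W ((θ (w fz) p0 -F θ (w (fromℕ m)) pm) ·W vo T (w fz)))
lemma1 _ T _ _ _ _ _ _ _ _ _ θ _ μ μ-ok m w walk =
  walkSumO-telescopes , walkSumB-telescopes , terminal-combination
  where
  walkSumO-telescopes : walkSumO T μ m w ≈W vo T (w (fromℕ m)) -W vo T (w fz)
  walkSumO-telescopes = walkSum-telescopes (vo T) μ m w (λ i → μ-ok _ _ (walk i))

  walkSumB-telescopes : walkSumB T θ μ m w ≈W vb T θ (w (fromℕ m)) -W vb T θ (w fz)
  walkSumB-telescopes = walkSum-telescopes (vb T θ) μ m w (λ i → μ-ok _ _ (walk i))

  terminal-combination : (p₀ : w fz ∈ T) (pₘ : w (fromℕ m) ∈ T) →
    θ (w (fromℕ m)) pₘ ·W walkSumO T μ m w -W walkSumB T θ μ m w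
      ≈W (θ (w fz) p₀ -F θ (w (fromℕ m)) pₘ) ·W vo T (w fz)
  terminal-combination p₀ pₘ =
    eliminate-endpoint (θ _ p₀) (θ _ pₘ) walkSumO-telescopes walkSumB-telescopes (vb-∈ θ pₘ) (vb-∈ θ p₀)
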